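{- For all integers $n\geq i\geq 0$, the number $f_{n,i}$ of ballotlike paths from $(0,0)$ to $(n,i)$ containing at least one $D$ step equals $$f_{n,i}=\binom{2n-2}{n-i-1}-\binom{2n-2}{n-i-2}-\binom{n-2}{n-i-1}.$$
   Context: Binomial coefficients are defined for all integers $m$ and $j$ by $\binom{m}{j}=\frac{m(m-1)\cdots(m-j+1)}{j!}$ for $j\geq 0$ and $\binom{m}{j}=0$ for $j<0$. A ballotlike path ending at $(n,i)$ is a lattice path from $(0,0)$ to $(n,i)$ staying in the region $y\geq 0$, using steps $U=(1,1)$, $D=(1,-1)$, and horizontal steps $(1,0)$ each colored umber or denim, such that no umber horizontal step occurs at height zero and no denim horizontal step occurs before the first $D$ step. -}

module Defs where

open import Data.Bool using (Bool; true; false; _∧_; _∨_)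
open import Data.Nat as ℕ using (ℕ; zero; suc; _!)
open import Data.Nat.Properties using (_!≢0)
open import Data.Integer as ℤ using (ℤ; +_; -[1+_]; _-_; _*_; _/ℕ_)
open import Data.List using (List; []; _∷_; map; concatMap; filterᵇ; length)
open import Relation.Nullary.Decidable using (does)
open import Relation.Binary.PropositionalEquality using (_≡_)

falling : ℤ → ℕ → ℤ
falling m zero    = + 1
falling m (suc k) = falling m k * (m - + k)

binom : ℤ → ℤ → ℤ
binom m (+ j)      = _/ℕ_ (falling m j) (j !) {{j !≢0}}
binom m -[1+ _ ]   = + 0

-- Steps: U = (1,1), D = (1,-1), Hu = umber horizontal, Hd = denim horizontal.

data Step : Set where
  U D Hu Hd : Step

allPaths : ℕ → List (List Step)
allPaths zero    = [] ∷ []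
allPaths (suc n) = concatMap (λ p → map (_∷ p) (U ∷ D ∷ Hu ∷ Hd ∷ [])) (allPaths n)

-- Walk from the current height h, with flag d = "a D step has already
-- occurred", checking: height stays ≥ 0, no umber horizontal step at
-- height 0, no denim horizontal step before the first D step; at the end
-- the height must equal the target i.
ballotFrom : ℕ → Bool → List Step → ℕ → Bool
ballotFrom h       d     []        i = does (h ℕ.≟ i)
ballotFrom h       d     (U ∷ s)   i = ballotFrom (suc h) d s i
ballotFrom zero    d     (D ∷ s)   i = false
ballotFrom (suc h) d     (D ∷ s)   i = ballotFrom h true s i
ballotFrom zero    d     (Hu ∷ s)  i = false
ballotFrom (suc h) d     (Hu ∷ s)  i = ballotFrom (suc h) d s i
ballotFrom h       false (Hd ∷ s)  i = false
ballotFrom h       true  (Hd ∷ s)  i = ballotFrom h true s i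

isBallotlike : ℕ → List Step → Bool
isBallotlike i p = ballotFrom 0 false p i

containsD : List Step → Bool
containsD []       = false
containsD (D ∷ s)  = true
containsD (_ ∷ s)  = containsD s

f : ℕ → ℕ → ℕ
f n i = length (filterᵇ (λ p → isBallotlike i p ∧ containsD p) (allPaths n))

-- Split a ballotlike path at its first D step.  Before it only U and umber steps are
-- allowed; after it, reading U, D and the two coloured horizontal steps as the four
-- pairs of ±1 half-steps turns the path into a simple walk of twice the length that
-- stays nonnegative, counted by the reflection principle.  The counts of both phases
-- obey first-step recurrences, and Pascal's rule shows that the binomial closed forms
-- obey the same ones.  A path containing a D must start with U, so f (m+2) i is the
-- count of (m+1)-step paths from height 1, whose closed form is the stated formula.
module Submission where

open import Defs
open import Data.Bool using (Bool; true; false; _∧_; if_then_else_; T)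
open import Data.Bool.Properties using (∧-identityʳ)
open import Data.Integer using (ℤ; +_; _⊖_; _-_; _*_; _+_; 0ℤ)
import Data.Integer.Properties as ℤP
open import Data.Integer.Tactic.RingSolver using (solve-∀)
open import Data.List using (List; []; _∷_; _++_; concatMap; filterᵇ; length)
open import Data.List.Properties using (length-++; filter-++)
open import Data.Nat as ℕ using (ℕ; zero; suc; _≤_; _<_; _!; s≤s)
import Data.Nat.Properties as ℕP
open import Data.Nat.Combinatorics using (_C_; _P_; nCk≡nPk/k!; k>n⇒nCk≡0; nCk+nC[k+1]≡[n+1]C[k+1])
open import Data.Nat.Combinatorics.Base using (_P′_)
open import Data.Nat.DivMod using (/-congˡ; 0/n≡0)
import Data.Nat.Tactic.RingSolver as ℕSolver
open import Data.Sum using (inj₁; inj₂)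
open import Relation.Nullary using (yes; no; does; contradiction)
open import Relation.Binary.PropositionalEquality
open ≡-Reasoning

P≡P′ : ∀ {m k} → k ≤ m → m P k ≡ m P′ k
P≡P′ {m} {k} k≤m with k ℕ.≤ᵇ m in eq
... | true  = refl
... | false = contradiction (ℕP.≤⇒≤ᵇ k≤m) (subst T eq)

falling≡P′ : ∀ {m k} → k ≤ m → falling (+ m) k ≡ + (m P′ k)
falling≡P′ {k = zero}    _   = refl
falling≡P′ {m} {suc k} k<m = begin
  falling (+ m) k * (+ m - + k)  ≡⟨ cong₂ _*_ (falling≡P′ k≤m) m-k≡m∸k ⟩
  + (m P′ k) * + (m ℕ.∸ k)       ≡⟨ ℤP.pos-* (m P′ k) (m ℕ.∸ k) ⟨
  + ((m P′ k) ℕ.* (m ℕ.∸ k))     ≡⟨ cong +_ (ℕP.*-comm (m P′ k) (m ℕ.∸ k)) ⟩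
  + (m P′ suc k)                 ∎
  where
  k≤m : k ≤ m
  k≤m = ℕP.<⇒≤ k<m
  m-k≡m∸k : + m - + k ≡ + (m ℕ.∸ k)
  m-k≡m∸k = trans (ℤP.[+m]-[+n]≡m⊖n m k) (ℤP.⊖-≥ k≤m)

falling≡0 : ∀ {m k} → m < k → falling (+ m) k ≡ 0ℤ
falling≡0 {m} {suc k} (s≤s m≤k) with ℕP.m≤n⇒m<n∨m≡n m≤k
... | inj₁ m<k  = cong (_* (+ m - + k)) (falling≡0 m<k)
... | inj₂ refl =
  trans (cong (falling (+ m) m *_) (ℤP.+-inverseʳ (+ m))) (ℤP.*-zeroʳ (falling (+ m) m))

binom≡C : ∀ m k → binom (+ m) (+ k) ≡ + (m C k)
binom≡C m k with k ℕ.≤? m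
... | yes k≤m rewrite falling≡P′ k≤m =
  cong +_ (sym (trans (nCk≡nPk/k! k≤m) (/-congˡ {{k ℕP.!≢0}} (P≡P′ k≤m))))
... | no k≰m rewrite falling≡0 (ℕP.≰⇒> k≰m) =
  cong +_ (trans (0/n≡0 (k !) {{k ℕP.!≢0}}) (sym (k>n⇒nCk≡0 (ℕP.≰⇒> k≰m))))

infixl 6.5 _C[_⊖_]

_C[_⊖_] : ℕ → ℕ → ℕ → ℕ
n C[ a     ⊖ zero  ] = n C a
n C[ zero  ⊖ suc b ] = 0
n C[ suc a ⊖ suc b ] = n C[ a ⊖ b ]

binom-⊖≡C[⊖] : ∀ n a b → binom (+ n) (a ⊖ b) ≡ + (n C[ a ⊖ b ])
binom-⊖≡C[⊖] n a       zero    = binom≡C n a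
binom-⊖≡C[⊖] n zero    (suc b) = refl
binom-⊖≡C[⊖] n (suc a) (suc b) =
  trans (cong (binom (+ n)) (ℤP.[1+m]⊖[1+n]≡m⊖n a b)) (binom-⊖≡C[⊖] n a b)

C[⊖]-pascal : ∀ n a b → suc n C[ a ⊖ b ] ≡ n C[ a ⊖ suc b ] ℕ.+ n C[ a ⊖ b ]
C[⊖]-pascal n zero    zero    = refl
C[⊖]-pascal n (suc a) zero    = sym (nCk+nC[k+1]≡[n+1]C[k+1] n a)
C[⊖]-pascal n zero    (suc b) = refl
C[⊖]-pascal n (suc a) (suc b) = C[⊖]-pascal n a b

0C[⊖]-comm : ∀ a b → 0 C[ a ⊖ b ] ≡ 0 C[ b ⊖ a ]
0C[⊖]-comm zero    zero    = refl
0C[⊖]-comm zero    (suc b) = refl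
0C[⊖]-comm (suc a) zero    = refl
0C[⊖]-comm (suc a) (suc b) = 0C[⊖]-comm a b

C[⊖]-sym : ∀ n a b → n C[ a ⊖ b ] ≡ n C[ n ℕ.+ b ⊖ a ]
C[⊖]-sym zero    a b = 0C[⊖]-comm a b
C[⊖]-sym (suc n) a b = begin
  suc n C[ a ⊖ b ]
    ≡⟨ C[⊖]-pascal n a b ⟩
  n C[ a ⊖ suc b ] ℕ.+ n C[ a ⊖ b ]
    ≡⟨ cong₂ ℕ._+_ (C[⊖]-sym n a (suc b)) (C[⊖]-sym n a b) ⟩
  n C[ n ℕ.+ suc b ⊖ a ] ℕ.+ n C[ n ℕ.+ b ⊖ a ]
    ≡⟨ ℕP.+-comm (n C[ n ℕ.+ suc b ⊖ a ]) _ ⟩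
  n C[ n ℕ.+ b ⊖ a ] ℕ.+ n C[ n ℕ.+ suc b ⊖ a ]
    ≡⟨ cong (λ c → n C[ n ℕ.+ b ⊖ a ] ℕ.+ n C[ c ⊖ a ]) (ℕP.+-suc n b) ⟩
  n C[ suc n ℕ.+ b ⊖ suc a ] ℕ.+ n C[ suc n ℕ.+ b ⊖ a ]
    ≡⟨ C[⊖]-pascal n (suc n ℕ.+ b) a ⟨
  suc n C[ suc n ℕ.+ b ⊖ a ]
    ∎

C[+⊖]-cancel : ∀ n a b → n C[ b ℕ.+ a ⊖ b ] ≡ n C a
C[+⊖]-cancel n a zero    = refl
C[+⊖]-cancel n a (suc b) = C[+⊖]-cancel n a b

C[⊖]-complement : ∀ {n a b k} → n ℕ.+ b ≡ a ℕ.+ k → n C[ a ⊖ b ] ≡ n C k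
C[⊖]-complement {n} {a} {b} {k} n+b≡a+k =
  trans (C[⊖]-sym n a b) (trans (cong (λ c → n C[ c ⊖ a ]) n+b≡a+k) (C[+⊖]-cancel n k a))

count : {A : Set} → (A → Bool) → List A → ℕ
count Q xs = length (filterᵇ Q xs)

count-∷ : ∀ {A : Set} (Q : A → Bool) x xs → count Q (x ∷ xs) ≡ (if Q x then 1 else 0) ℕ.+ count Q xs
count-∷ Q x xs with Q x
... | true  = refl
... | false = refl

count-++ : ∀ {A : Set} (Q : A → Bool) xs ys → count Q (xs ++ ys) ≡ count Q xs ℕ.+ count Q ys
count-++ Q xs ys = trans (cong length (filter-++ _ xs ys)) (length-++ (filterᵇ Q xs))

count-false : ∀ {A : Set} (xs : List A) → count (λ _ → false) xs ≡ 0
count-false []       = refl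
count-false (x ∷ xs) = count-false xs

count-cong : ∀ {A : Set} {Q R : A → Bool} → (∀ x → Q x ≡ R x) → ∀ xs → count Q xs ≡ count R xs
count-cong Q≗R []       = refl
count-cong {Q = Q} {R} Q≗R (x ∷ xs) = begin
  count Q (x ∷ xs)                       ≡⟨ count-∷ Q x xs ⟩
  (if Q x then 1 else 0) ℕ.+ count Q xs  ≡⟨ cong₂ (λ b c → (if b then 1 else 0) ℕ.+ c) (Q≗R x) (count-cong Q≗R xs) ⟩
  (if R x then 1 else 0) ℕ.+ count R xs  ≡⟨ count-∷ R x xs ⟨
  count R (x ∷ xs)                       ∎

count-allPaths-suc : ∀ (Q : List Step → Bool) n →
  count Q (allPaths (suc n)) ≡
    count (λ p → Q (U ∷ p)) (allPaths n) ℕ.+ count (λ p → Q (D ∷ p)) (allPaths n)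
      ℕ.+ count (λ p → Q (Hu ∷ p)) (allPaths n) ℕ.+ count (λ p → Q (Hd ∷ p)) (allPaths n)
count-allPaths-suc Q n = go (allPaths n)
  where
  extensions : List Step → List (List Step)
  extensions p = (U ∷ p) ∷ (D ∷ p) ∷ (Hu ∷ p) ∷ (Hd ∷ p) ∷ []

  hit : Step → List Step → ℕ
  hit s p = if Q (s ∷ p) then 1 else 0

  hits : Step → List (List Step) → ℕ
  hits s ps = count (λ p → Q (s ∷ p)) ps

  count-extensions : ∀ p → count Q (extensions p) ≡ hit U p ℕ.+ (hit D p ℕ.+ (hit Hu p ℕ.+ (hit Hd p ℕ.+ 0)))
  count-extensions p =
    trans (count-∷ Q _ _) (cong (hit U p ℕ.+_)
      (trans (count-∷ Q _ _) (cong (hit D p ℕ.+_)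
        (trans (count-∷ Q _ _) (cong (hit Hu p ℕ.+_) (count-∷ Q _ _))))))

  interleave : ∀ a b c d A B C D →
    a ℕ.+ (b ℕ.+ (c ℕ.+ (d ℕ.+ 0))) ℕ.+ (A ℕ.+ B ℕ.+ C ℕ.+ D)
      ≡ (a ℕ.+ A) ℕ.+ (b ℕ.+ B) ℕ.+ (c ℕ.+ C) ℕ.+ (d ℕ.+ D)
  interleave = ℕSolver.solve-∀

  go : ∀ ps → count Q (concatMap extensions ps) ≡ hits U ps ℕ.+ hits D ps ℕ.+ hits Hu ps ℕ.+ hits Hd ps
  go []       = refl
  go (p ∷ ps) = begin
    count Q (extensions p ++ concatMap extensions ps)
      ≡⟨ count-++ Q (extensions p) _ ⟩
    count Q (extensions p) ℕ.+ count Q (concatMap extensions ps)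
      ≡⟨ cong₂ ℕ._+_ (count-extensions p) (go ps) ⟩
    hit U p ℕ.+ (hit D p ℕ.+ (hit Hu p ℕ.+ (hit Hd p ℕ.+ 0)))
      ℕ.+ (hits U ps ℕ.+ hits D ps ℕ.+ hits Hu ps ℕ.+ hits Hd ps)
      ≡⟨ interleave (hit U p) (hit D p) (hit Hu p) (hit Hd p)
                    (hits U ps) (hits D ps) (hits Hu ps) (hits Hd ps) ⟩
    (hit U p ℕ.+ hits U ps) ℕ.+ (hit D p ℕ.+ hits D ps)
      ℕ.+ (hit Hu p ℕ.+ hits Hu ps) ℕ.+ (hit Hd p ℕ.+ hits Hd ps)
      ≡⟨ cong₂ ℕ._+_ (cong₂ ℕ._+_ (cong₂ ℕ._+_ (count-after U) (count-after D)) (count-after Hu))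
                     (count-after Hd) ⟨
    hits U (p ∷ ps) ℕ.+ hits D (p ∷ ps) ℕ.+ hits Hu (p ∷ ps) ℕ.+ hits Hd (p ∷ ps) ∎
    where
    count-after : ∀ s → hits s (p ∷ ps) ≡ hit s p ℕ.+ hits s ps
    count-after s = count-∷ (λ q → Q (s ∷ q)) p ps

count-ballotFrom-[] : ∀ h i → count (λ p → ballotFrom h true p i) (allPaths 0) ≡ 0 C[ i ⊖ h ]
count-ballotFrom-[] h i = trans (count-∷ (λ p → ballotFrom h true p i) [] []) (indicator h i)
  where
  indicator : ∀ h i → (if does (h ℕ.≟ i) then 1 else 0) ℕ.+ 0 ≡ 0 C[ i ⊖ h ]
  indicator zero    zero    = refl
  indicator zero    (suc i) = refl
  indicator (suc h) zero    = refl
  indicator (suc h) (suc i) = indicator h i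

regroup : ∀ a b c d → (a + b) - (c + d) ≡ (a - d) + (b - c)
regroup = solve-∀

module _ (i : ℕ) where

  -- Walks of n steps from height h that end at height i, respectively after the
  -- first D (denim steps allowed) and before it (no denim step, but a D must follow).
  afterD beforeD : ℕ → ℕ → ℕ
  afterD  n h = count (λ p → ballotFrom h true p i) (allPaths n)
  beforeD n h = count (λ p → ballotFrom h false p i ∧ containsD p) (allPaths n)

  afterD-suc-zero : ∀ n → afterD (suc n) 0 ≡ afterD n 1 ℕ.+ afterD n 0
  afterD-suc-zero n = begin
    afterD (suc n) 0
      ≡⟨ count-allPaths-suc (λ p → ballotFrom 0 true p i) n ⟩
    afterD n 1 ℕ.+ count (λ _ → false) ps ℕ.+ count (λ _ → false) ps ℕ.+ afterD n 0
      ≡⟨ cong (λ c → afterD n 1 ℕ.+ c ℕ.+ c ℕ.+ afterD n 0) (count-false ps) ⟩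
    afterD n 1 ℕ.+ 0 ℕ.+ 0 ℕ.+ afterD n 0
      ≡⟨ cong (ℕ._+ afterD n 0) (trans (ℕP.+-identityʳ _) (ℕP.+-identityʳ _)) ⟩
    afterD n 1 ℕ.+ afterD n 0 ∎
    where
    ps : List (List Step)
    ps = allPaths n

  afterD-suc-suc : ∀ n h → afterD (suc n) (suc h) ≡
    afterD n (suc (suc h)) ℕ.+ afterD n h ℕ.+ afterD n (suc h) ℕ.+ afterD n (suc h)
  afterD-suc-suc n h = count-allPaths-suc (λ p → ballotFrom (suc h) true p i) n

  beforeD-zero : ∀ h → beforeD 0 h ≡ 0
  beforeD-zero h with ballotFrom h false [] i
  ... | true  = refl
  ... | false = refl

  beforeD-suc-zero : ∀ n → beforeD (suc n) 0 ≡ beforeD n 1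
  beforeD-suc-zero n = begin
    beforeD (suc n) 0
      ≡⟨ count-allPaths-suc (λ p → ballotFrom 0 false p i ∧ containsD p) n ⟩
    beforeD n 1 ℕ.+ count (λ _ → false) ps ℕ.+ count (λ _ → false) ps ℕ.+ count (λ _ → false) ps
      ≡⟨ cong (λ c → beforeD n 1 ℕ.+ c ℕ.+ c ℕ.+ c) (count-false ps) ⟩
    beforeD n 1 ℕ.+ 0 ℕ.+ 0 ℕ.+ 0
      ≡⟨ trans (ℕP.+-identityʳ _) (trans (ℕP.+-identityʳ _) (ℕP.+-identityʳ _)) ⟩
    beforeD n 1 ∎
    where
    ps : List (List Step)
    ps = allPaths n

  beforeD-suc-suc : ∀ n h → beforeD (suc n) (suc h) ≡
    beforeD n (suc (suc h)) ℕ.+ afterD n h ℕ.+ beforeD n (suc h)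
  beforeD-suc-suc n h = begin
    beforeD (suc n) (suc h)
      ≡⟨ count-allPaths-suc (λ p → ballotFrom (suc h) false p i ∧ containsD p) n ⟩
    beforeD n (suc (suc h)) ℕ.+ count (λ p → ballotFrom h true p i ∧ true) ps
      ℕ.+ beforeD n (suc h) ℕ.+ count (λ _ → false) ps
      ≡⟨ cong₂ (λ a c → beforeD n (suc (suc h)) ℕ.+ a ℕ.+ beforeD n (suc h) ℕ.+ c)
               (count-cong (λ p → ∧-identityʳ _) ps) (count-false ps) ⟩
    beforeD n (suc (suc h)) ℕ.+ afterD n h ℕ.+ beforeD n (suc h) ℕ.+ 0
      ≡⟨ ℕP.+-identityʳ _ ⟩
    beforeD n (suc (suc h)) ℕ.+ afterD n h ℕ.+ beforeD n (suc h) ∎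
    where
    ps : List (List Step)
    ps = allPaths n

  -- Reflection-principle counts of simple ±1 walks staying ≥ 0: evenBallot n h counts
  -- 2n steps from 2h to 2i, oddBallot n h counts 2n+1 steps from 2h−1 to 2i.
  evenBallot oddBallot : ℕ → ℕ → ℤ
  evenBallot n h = + ((n ℕ.+ n) C[ n ℕ.+ i ⊖ h ]) - + ((n ℕ.+ n) C suc (h ℕ.+ (n ℕ.+ i)))
  oddBallot  n h = + (suc (n ℕ.+ n) C[ suc (n ℕ.+ i) ⊖ h ]) - + (suc (n ℕ.+ n) C suc (h ℕ.+ (n ℕ.+ i)))

  oddBallot-zero : ∀ n → oddBallot n 0 ≡ 0ℤ
  oddBallot-zero n = ℤP.+-inverseʳ (+ (suc (n ℕ.+ n) C suc (n ℕ.+ i)))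

  oddBallot-suc : ∀ n h → oddBallot n (suc h) ≡ evenBallot n (suc h) + evenBallot n h
  oddBallot-suc n h = begin
    + (suc N C[ c ⊖ h ]) - + (suc N C suc (suc (h ℕ.+ c)))
      ≡⟨ cong₂ (λ a b → + a - + b) (C[⊖]-pascal N c h)
               (sym (nCk+nC[k+1]≡[n+1]C[k+1] N (suc (h ℕ.+ c)))) ⟩
    (+ (N C[ c ⊖ suc h ]) + + (N C[ c ⊖ h ]))
      - (+ (N C suc (h ℕ.+ c)) + + (N C suc (suc (h ℕ.+ c))))
      ≡⟨ regroup (+ (N C[ c ⊖ suc h ])) (+ (N C[ c ⊖ h ]))
                 (+ (N C suc (h ℕ.+ c))) (+ (N C suc (suc (h ℕ.+ c)))) ⟩
    evenBallot n (suc h) + evenBallot n h ∎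
    where
    N c : ℕ
    N = n ℕ.+ n
    c = n ℕ.+ i

  evenBallot-suc : ∀ n h → evenBallot (suc n) h ≡ oddBallot n (suc h) + oddBallot n h
  evenBallot-suc n h = begin
    + ((suc n ℕ.+ suc n) C[ suc c ⊖ h ]) - + ((suc n ℕ.+ suc n) C suc (h ℕ.+ suc c))
      ≡⟨ cong₂ (λ M k → + (M C[ suc c ⊖ h ]) - + (M C suc k)) (ℕP.+-suc (suc n) n) (ℕP.+-suc h c) ⟩
    + (suc (suc N) C[ suc c ⊖ h ]) - + (suc (suc N) C suc (suc (h ℕ.+ c)))
      ≡⟨ cong₂ (λ a b → + a - + b) (C[⊖]-pascal (suc N) (suc c) h)
               (sym (nCk+nC[k+1]≡[n+1]C[k+1] (suc N) (suc (h ℕ.+ c)))) ⟩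
    (+ (suc N C[ c ⊖ h ]) + + (suc N C[ suc c ⊖ h ]))
      - (+ (suc N C suc (h ℕ.+ c)) + + (suc N C suc (suc (h ℕ.+ c))))
      ≡⟨ regroup (+ (suc N C[ c ⊖ h ])) (+ (suc N C[ suc c ⊖ h ]))
                 (+ (suc N C suc (h ℕ.+ c))) (+ (suc N C suc (suc (h ℕ.+ c)))) ⟩
    oddBallot n (suc h) + oddBallot n h ∎
    where
    N c : ℕ
    N = n ℕ.+ n
    c = n ℕ.+ i

  afterD≡evenBallot : ∀ n h → + afterD n h ≡ evenBallot n h
  afterD≡evenBallot zero h =
    trans (cong +_ (count-ballotFrom-[] h i)) (sym (ℤP.+-identityʳ (+ (0 C[ i ⊖ h ]))))
  afterD≡evenBallot (suc n) zero = begin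
    + afterD (suc n) 0                              ≡⟨ cong +_ (afterD-suc-zero n) ⟩
    + afterD n 1 + + afterD n 0                     ≡⟨ cong₂ _+_ (afterD≡evenBallot n 1) (afterD≡evenBallot n 0) ⟩
    evenBallot n 1 + evenBallot n 0                 ≡⟨ ℤP.+-identityʳ _ ⟨
    evenBallot n 1 + evenBallot n 0 + 0ℤ            ≡⟨ cong₂ _+_ (oddBallot-suc n 0) (oddBallot-zero n) ⟨
    oddBallot n 1 + oddBallot n 0                   ≡⟨ evenBallot-suc n 0 ⟨
    evenBallot (suc n) 0                            ∎
  afterD≡evenBallot (suc n) (suc h) = begin
    + afterD (suc n) (suc h)
      ≡⟨ cong +_ (afterD-suc-suc n h) ⟩
    + afterD n (suc (suc h)) + + afterD n h + + afterD n (suc h) + + afterD n (suc h)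
      ≡⟨ cong₂ _+_ (cong₂ _+_ (cong₂ _+_ (afterD≡evenBallot n (suc (suc h))) (afterD≡evenBallot n h))
                               (afterD≡evenBallot n (suc h))) (afterD≡evenBallot n (suc h)) ⟩
    evenBallot n (suc (suc h)) + evenBallot n h + evenBallot n (suc h) + evenBallot n (suc h)
      ≡⟨ regroup₃ (evenBallot n (suc (suc h))) (evenBallot n (suc h)) (evenBallot n h) ⟩
    (evenBallot n (suc (suc h)) + evenBallot n (suc h)) + (evenBallot n (suc h) + evenBallot n h)
      ≡⟨ cong₂ _+_ (oddBallot-suc n (suc h)) (oddBallot-suc n h) ⟨
    oddBallot n (suc (suc h)) + oddBallot n (suc h)
      ≡⟨ evenBallot-suc n (suc h) ⟨
    evenBallot (suc n) (suc h) ∎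
    where
    regroup₃ : ∀ a b c → a + c + b + b ≡ (a + b) + (b + c)
    regroup₃ = solve-∀

  evenBallot-zero-suc : ∀ h → evenBallot 0 (suc h) ≡ + (0 C[ suc h ⊖ i ])
  evenBallot-zero-suc h = trans (ℤP.+-identityʳ _) (cong +_ (0C[⊖]-comm i (suc h)))

  beforeDFormula : ℕ → ℕ → ℤ
  beforeDFormula m h = oddBallot m h - + (m C[ m ℕ.+ h ⊖ i ])

  beforeDFormula-suc : ∀ m h → beforeDFormula (suc m) (suc h) ≡
    beforeDFormula m (suc (suc h)) + evenBallot (suc m) h + beforeDFormula m (suc h)
  beforeDFormula-suc m h = begin
    oddBallot (suc m) (suc h) - + (suc m C[ suc (m ℕ.+ suc h) ⊖ i ])
      ≡⟨ cong₂ _-_ (oddBallot-suc (suc m) h) (cong +_ (C[⊖]-pascal m (suc (m ℕ.+ suc h)) i)) ⟩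
    (evenBallot (suc m) (suc h) + evenBallot (suc m) h) - (+ s₁ + + (m C[ suc (m ℕ.+ suc h) ⊖ i ]))
      ≡⟨ cong₂ (λ e k → (e + evenBallot (suc m) h) - (+ s₁ + + (m C[ k ⊖ i ])))
               (evenBallot-suc m (suc h)) (sym (ℕP.+-suc m (suc h))) ⟩
    (o₂ + o₁ + evenBallot (suc m) h) - (+ s₁ + + s₂)
      ≡⟨ regroup₅ o₂ o₁ (evenBallot (suc m) h) (+ s₁) (+ s₂) ⟩
    (o₂ - + s₂) + evenBallot (suc m) h + (o₁ - + s₁) ∎
    where
    o₁ o₂ : ℤ
    o₁ = oddBallot m (suc h)
    o₂ = oddBallot m (suc (suc h))
    s₁ s₂ : ℕ
    s₁ = m C[ m ℕ.+ suc h ⊖ i ]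
    s₂ = m C[ m ℕ.+ suc (suc h) ⊖ i ]
    regroup₅ : ∀ a b e c d → (a + b + e) - (c + d) ≡ (a - d) + e + (b - c)
    regroup₅ = solve-∀

  beforeD≡beforeDFormula : ∀ m h → + beforeD (suc m) (suc h) ≡ beforeDFormula m (suc h)
  beforeD≡beforeDFormula zero h = begin
    + beforeD 1 (suc h)
      ≡⟨ cong +_ (beforeD-suc-suc 0 h) ⟩
    + (beforeD 0 (suc (suc h)) ℕ.+ afterD 0 h ℕ.+ beforeD 0 (suc h))
      ≡⟨ cong₂ (λ a b → + (a ℕ.+ afterD 0 h ℕ.+ b)) (beforeD-zero (suc (suc h))) (beforeD-zero (suc h)) ⟩
    + (afterD 0 h ℕ.+ 0)
      ≡⟨ cong +_ (ℕP.+-identityʳ _) ⟩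
    + afterD 0 h
      ≡⟨ afterD≡evenBallot 0 h ⟩
    evenBallot 0 h
      ≡⟨ cancel (+ (0 C[ suc h ⊖ i ])) (evenBallot 0 h) ⟨
    (+ (0 C[ suc h ⊖ i ]) + evenBallot 0 h) - + (0 C[ suc h ⊖ i ])
      ≡⟨ cong (λ e → (e + evenBallot 0 h) - + (0 C[ suc h ⊖ i ])) (evenBallot-zero-suc h) ⟨
    (evenBallot 0 (suc h) + evenBallot 0 h) - + (0 C[ suc h ⊖ i ])
      ≡⟨ cong (_- + (0 C[ suc h ⊖ i ])) (oddBallot-suc 0 h) ⟨
    beforeDFormula 0 (suc h) ∎
    where
    cancel : ∀ x e → (x + e) - x ≡ e
    cancel = solve-∀
  beforeD≡beforeDFormula (suc m) h = begin
    + beforeD (suc (suc m)) (suc h)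
      ≡⟨ cong +_ (beforeD-suc-suc (suc m) h) ⟩
    + beforeD (suc m) (suc (suc h)) + + afterD (suc m) h + + beforeD (suc m) (suc h)
      ≡⟨ cong₂ _+_ (cong₂ _+_ (beforeD≡beforeDFormula m (suc h)) (afterD≡evenBallot (suc m) h))
                   (beforeD≡beforeDFormula m h) ⟩
    beforeDFormula m (suc (suc h)) + evenBallot (suc m) h + beforeDFormula m (suc h)
      ≡⟨ beforeDFormula-suc m h ⟨
    beforeDFormula (suc m) (suc h) ∎

  oddBallot-one : ∀ m → oddBallot m 1 ≡ evenBallot (suc m) 0
  oddBallot-one m = sym (begin
    evenBallot (suc m) 0            ≡⟨ evenBallot-suc m 0 ⟩
    oddBallot m 1 + oddBallot m 0   ≡⟨ cong (_+_ (oddBallot m 1)) (oddBallot-zero m) ⟩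
    oddBallot m 1 + 0ℤ              ≡⟨ ℤP.+-identityʳ (oddBallot m 1) ⟩
    oddBallot m 1                   ∎)

binomials≡evenBallot : ∀ m i →
  binom (+ 2 * + suc (suc m) - + 2) (+ suc (suc m) - + i - + 1)
  - binom (+ 2 * + suc (suc m) - + 2) (+ suc (suc m) - + i - + 2)
  - binom (+ suc (suc m) - + 2) (+ suc (suc m) - + i - + 1)
  ≡ evenBallot i (suc m) 0 - + (m C[ m ℕ.+ 1 ⊖ i ])
binomials≡evenBallot m i = begin
  binom (+ 2 * + n - + 2) (+ n - + i - + 1) - binom (+ 2 * + n - + 2) (+ n - + i - + 2)
    - binom (+ n - + 2) (+ n - + i - + 1)
    ≡⟨ cong₂ _-_ (cong₂ _-_ (binom-at M (m ℕ.+ 1) i (top (+ m)) index₁)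
                            (binom-at M m i (top (+ m)) index₂))
                 (binom-at m (m ℕ.+ 1) i (top′ (+ m)) index₁) ⟩
  + (M C[ m ℕ.+ 1 ⊖ i ]) - + (M C[ m ⊖ i ]) - + (m C[ m ℕ.+ 1 ⊖ i ])
    ≡⟨ cong₂ (λ a b → + a - + b - + (m C[ m ℕ.+ 1 ⊖ i ]))
             (C[⊖]-complement {M} {m ℕ.+ 1} {i} (complement₁ m i))
             (C[⊖]-complement {M} {m} {i} (complement₂ m i)) ⟩
  evenBallot i (suc m) 0 - + (m C[ m ℕ.+ 1 ⊖ i ]) ∎
  where
  n M : ℕ
  n = suc (suc m)
  M = suc m ℕ.+ suc m

  binom-at : ∀ {t k} N a b → t ≡ + N → k ≡ a ⊖ b → binom t k ≡ + (N C[ a ⊖ b ])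
  binom-at N a b refl refl = binom-⊖≡C[⊖] N a b

  top : ∀ x → + 2 * (+ 2 + x) - + 2 ≡ (+ 1 + x) + (+ 1 + x)
  top = solve-∀
  top′ : ∀ x → (+ 2 + x) - + 2 ≡ x
  top′ = solve-∀

  index₁ : + n - + i - + 1 ≡ (m ℕ.+ 1) ⊖ i
  index₁ = trans (shift (+ m) (+ i)) (ℤP.[+m]-[+n]≡m⊖n (m ℕ.+ 1) i)
    where shift : ∀ x y → + 2 + x - y - + 1 ≡ x + + 1 - y
          shift = solve-∀
  index₂ : + n - + i - + 2 ≡ m ⊖ i
  index₂ = trans (shift (+ m) (+ i)) (ℤP.[+m]-[+n]≡m⊖n m i)
    where shift : ∀ x y → + 2 + x - y - + 2 ≡ x - y
          shift = solve-∀

  complement₁ : ∀ m i → (suc m ℕ.+ suc m) ℕ.+ i ≡ (m ℕ.+ 1) ℕ.+ suc (m ℕ.+ i)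
  complement₁ = ℕSolver.solve-∀
  complement₂ : ∀ m i → (suc m ℕ.+ suc m) ℕ.+ i ≡ m ℕ.+ suc (suc (m ℕ.+ i))
  complement₂ = ℕSolver.solve-∀

lemma15 : (n i : ℕ) → i ≤ n →
    + (f n i) ≡ binom (+ 2 * + n - + 2) (+ n - + i - + 1)
    - binom (+ 2 * + n - + 2) (+ n - + i - + 2)
    - binom (+ n - + 2) (+ n - + i - + 1)
lemma15 zero          zero          _        = refl
lemma15 (suc zero)    zero          _        = refl
lemma15 (suc zero)    (suc zero)    _        = refl
lemma15 (suc zero)    (suc (suc i)) (s≤s ())
lemma15 (suc (suc m)) i             _        = begin
  + f (suc (suc m)) i                                 ≡⟨⟩
  + beforeD i (suc (suc m)) 0                         ≡⟨ cong +_ (beforeD-suc-zero i (suc m)) ⟩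
  + beforeD i (suc m) 1                               ≡⟨ beforeD≡beforeDFormula i m 0 ⟩
  oddBallot i m 1 - + (m C[ m ℕ.+ 1 ⊖ i ])            ≡⟨ cong (_- + (m C[ m ℕ.+ 1 ⊖ i ])) (oddBallot-one i m) ⟩
  evenBallot i (suc m) 0 - + (m C[ m ℕ.+ 1 ⊖ i ])     ≡⟨ binomials≡evenBallot m i ⟨
  binom (+ 2 * + n - + 2) (+ n - + i - + 1) - binom (+ 2 * + n - + 2) (+ n - + i - + 2)
    - binom (+ n - + 2) (+ n - + i - + 1)             ∎
  where
  n : ℕ
  n = suc (suc m)
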